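{- Let the edges of $K_n$ be colored red and blue, where an edge may receive both colors, every edge receives at least one color, and neither the red graph nor the blue graph contains an induced $C_4$. Let $K_5^*$ denote the $2$-colored $K_5$ in which each edge has exactly one color and both color classes form a $C_5$. Suppose $K_n$ contains a copy of $K_5^*$, and let $K$ be a maximal subgraph of $K_n$ that can be obtained from $K_5^*$ by substituting cliques with vertex sets $X_1,\dots,X_5$ into its five vertices. Here the edges inside each $X_i$ have both colors, and the complete bipartite graphs $[X_i,X_{i+1}]$ have only red edges and $[X_i,X_{i+2}]$ only blue edges (indices mod $5$). Maximal means that no vertex of $K_n$ outside $V(K)$ is a replica of a vertex of $K$, i.e. no such vertex can be added to some $X_i$ so that the result is again a blow-up of $K_5^*$ of this form inside $K_n$. Then for every vertex $w\in V(K_n)\setminus V(K)$, all edges between $w$ and $V(K)$ have a common color.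
   Context: A clique substitution replaces a vertex $v$ by a clique $X$ all of whose internal edges carry both colors, and each edge between $X$ and another vertex $u$ receives exactly the colors of the edge $(u,v)$. A vertex $w$ is a replica of $v$ if $(w,v)$ has both colors and, for every other vertex $u$, the edge $(w,u)$ has the same colors as $(v,u)$. -}

module Defs where

open import Data.Nat using (ℕ; _+_; _∸_)
open import Data.Nat.DivMod using (_%_)
open import Data.Bool using (Bool; true; false; if_then_else_)
open import Data.Fin using (Fin; toℕ) renaming (_≟_ to _≟ᶠ_)
open import Data.Maybe using (Maybe; just; nothing)
open import Data.Product using (_×_; _,_; ∃)
open import Data.Sum using (_⊎_)
open import Relation.Nullary using (¬_; does)
open import Relation.Binary.PropositionalEquality using (_≡_; _≢_)

-- A red/blue colouring of the edges of K_n (vertex set Fin n).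
-- Edges may carry both colours; every edge carries at least one colour.
-- Values on the diagonal (u , u) are irrelevant.
record Coloring (n : ℕ) : Set where
  field
    red      : Fin n → Fin n → Bool
    blue     : Fin n → Fin n → Bool
    red-sym  : ∀ u v → red u v ≡ red v u
    blue-sym : ∀ u v → blue u v ≡ blue v u
    covered  : ∀ u v → u ≢ v → red u v ≡ true ⊎ blue u v ≡ true
open Coloring public

InducedC4 : ∀ {n} → (Fin n → Fin n → Bool) → Set
InducedC4 {n} E =
  ∃ λ (a : Fin n) → ∃ λ (b : Fin n) → ∃ λ (c : Fin n) → ∃ λ (d : Fin n) →
    (a ≢ b × a ≢ c × a ≢ d × b ≢ c × b ≢ d × c ≢ d) ×
    (E a b ≡ true × E b c ≡ true × E c d ≡ true × E d a ≡ true) ×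
    (E a c ≡ false × E b d ≡ false)

-- Colour pattern of K5* blown up: pair (has red , has blue).
-- Parts i, j : Fin 5; j - i ≡ 0 : both colours, ≡ ±1 : red only, ≡ ±2 : blue only.
k5*colors : ℕ → Bool × Bool
k5*colors 0 = true , true
k5*colors 1 = true , false
k5*colors 2 = false , true
k5*colors 3 = false , true
k5*colors _ = true , false

partColors : Fin 5 → Fin 5 → Bool × Bool
partColors i j = k5*colors ((toℕ j + 5 ∸ toℕ i) % 5)

-- A blow-up of K5* inside K_n: p v = just i means v ∈ X_i, p v = nothing means v ∉ V(K).
IsBlowup : ∀ {n} → Coloring n → (Fin n → Maybe (Fin 5)) → Set
IsBlowup {n} c p =
  (∀ (i : Fin 5) → ∃ λ (v : Fin n) → p v ≡ just i) ×
  (∀ (u v : Fin n) (i j : Fin 5) → u ≢ v → p u ≡ just i → p v ≡ just j →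
     (red c u v , blue c u v) ≡ partColors i j)

update : ∀ {n} → (Fin n → Maybe (Fin 5)) → Fin n → Maybe (Fin 5) → Fin n → Maybe (Fin 5)
update p w x v = if does (v ≟ᶠ w) then x else p v

IsMaximalBlowup : ∀ {n} → Coloring n → (Fin n → Maybe (Fin 5)) → Set
IsMaximalBlowup {n} c p =
  IsBlowup c p ×
  (∀ (w : Fin n) (i : Fin 5) → p w ≡ nothing → ¬ IsBlowup c (update p w (just i)))

-- Suppose w is joined to some vertex of K only in blue and to some vertex of K only in red.
-- Induced-C4-freeness gives a propagation rule: if u v x is a red (blue) path of K5* whose ends
-- are joined to w in red (blue), then so is its middle vertex v, since otherwise w u v x is an
-- induced monochromatic C4. Up to the dihedral symmetry of K5* and at most one use of this rule,
-- the blue-only neighbour lies in X_0 and the red-only one in X_1; propagating around the 5-cycle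
-- then shows that w is joined to every X_j exactly as the vertices of X_2 are, so w is a replica,
-- contradicting maximality.
module Submission where

open import Defs
open import Data.Bool using (Bool; true; false)
open import Data.Bool.Properties using (¬-not) renaming (_≟_ to _≟ᵇ_)
open import Data.Empty using (⊥-elim)
open import Data.Fin using (Fin; zero; suc; toℕ) renaming (_≟_ to _≟ᶠ_)
open import Data.Fin.Patterns using (0F; 1F; 2F; 3F; 4F)
open import Data.Fin.Properties using (all?; any?)
open import Data.Maybe using (Maybe; just; nothing)
open import Data.Nat using (ℕ; _+_; _∸_)
open import Data.Nat.DivMod using (_mod_)
open import Data.Product using (_×_; _,_; ∃; proj₁; proj₂)
open import Data.Product.Properties using (≡-dec)
open import Data.Sum using (_⊎_; inj₁; inj₂)
open import Function using (_∘_)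
open import Relation.Binary.Definitions using (DecidableEquality)
open import Relation.Nullary using (¬_; yes; no; contradiction)
open import Relation.Nullary.Decidable using (toWitness)
open import Relation.Binary.PropositionalEquality using (_≡_; _≢_; refl; sym; trans; cong; cong₂; subst)

_≟_ : DecidableEquality (Bool × Bool)
_≟_ = ≡-dec _≟ᵇ_ _≟ᵇ_

partColors-diag : ∀ i → partColors i i ≡ (true , true)
partColors-diag = toWitness {a? = all? λ i → partColors i i ≟ (true , true)} _

partColors-sym : ∀ i j → partColors i j ≡ partColors j i
partColors-sym = toWitness {a? = all? λ i → all? λ j → partColors i j ≟ partColors j i} _

_⊕_ _⊖_ : Fin 5 → Fin 5 → Fin 5
s ⊕ x = (toℕ s + toℕ x) mod 5
s ⊖ x = (toℕ s + 5 ∸ toℕ x) mod 5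

⊕-identityʳ : ∀ s → s ⊕ 0F ≡ s
⊕-identityʳ = toWitness {a? = all? λ s → s ⊕ 0F ≟ᶠ s} _

record Automorphism : Set where
  field
    apply      : Fin 5 → Fin 5
    preserves  : ∀ x y → partColors (apply x) (apply y) ≡ partColors x y
    surjective : ∀ j → ∃ λ x → apply x ≡ j

open Automorphism

_∘ᴬ_ : Automorphism → Automorphism → Automorphism
apply (σ ∘ᴬ ρ) = apply σ ∘ apply ρ
preserves (σ ∘ᴬ ρ) x y = trans (preserves σ (apply ρ x) (apply ρ y)) (preserves ρ x y)
surjective (σ ∘ᴬ ρ) j with surjective σ j
... | y , refl with surjective ρ y
...   | x , refl = x , refl

rotation : Fin 5 → Automorphism
apply (rotation s) = s ⊕_
preserves (rotation s) = toWitness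
  {a? = all? λ s → all? λ x → all? λ y → partColors (s ⊕ x) (s ⊕ y) ≟ partColors x y} _ s
surjective (rotation s) = toWitness {a? = all? λ s → all? λ j → any? λ x → s ⊕ x ≟ᶠ j} _ s

reflection : Fin 5 → Automorphism
apply (reflection s) = s ⊖_
preserves (reflection s) = toWitness
  {a? = all? λ s → all? λ x → all? λ y → partColors (s ⊖ x) (s ⊖ y) ≟ partColors x y} _ s
surjective (reflection s) = toWitness {a? = all? λ s → all? λ j → any? λ x → s ⊖ x ≟ᶠ j} _ s

contraposeᵇ : ∀ {x y} → (x ≡ true → y ≡ true) → y ≡ false → x ≡ false
contraposeᵇ x⇒y y≡false = ¬-not λ x≡true → contradiction (trans (sym (x⇒y x≡true)) y≡false) λ ()

C4-free⇒chord : ∀ {n} {E : Fin n → Fin n → Bool} {a b c d} → ¬ InducedC4 E →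
  a ≢ b → a ≢ c → a ≢ d → b ≢ c → b ≢ d → c ≢ d →
  E a b ≡ true → E b c ≡ true → E c d ≡ true → E d a ≡ true → E b d ≡ false → E a c ≡ true
C4-free⇒chord {E = E} {a} {c = c} free a≢b a≢c a≢d b≢c b≢d c≢d ab bc cd da bd with E a c in ac
... | true  = refl
... | false = ⊥-elim (free (_ , _ , _ , _ , (a≢b , a≢c , a≢d , b≢c , b≢d , c≢d) , (ab , bc , cd , da) , (ac , bd)))

update-≢ : ∀ {n} {p : Fin n → Maybe (Fin 5)} {w v} x → v ≢ w → update p w x v ≡ p v
update-≢ {w = w} {v} x v≢w with v ≟ᶠ w
... | yes v≡w = contradiction v≡w v≢w
... | no _    = refl

isBlowup-update : ∀ {n} {c : Coloring n} {p w k} → IsBlowup c p → p w ≡ nothing →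
  (∀ v j → p v ≡ just j → (red c w v , blue c w v) ≡ partColors k j) →
  IsBlowup c (update p w (just k))
isBlowup-update {c = c} {p} {w} {k} (nonempty , coloured) w∉K replica = nonempty′ , coloured′
  where
  nonempty′ : ∀ i → ∃ λ v → update p w (just k) v ≡ just i
  nonempty′ i with nonempty i
  ... | v , pv = v , trans (update-≢ {p = p} (just k) λ { refl → contradiction (trans (sym w∉K) pv) λ () }) pv

  coloured′ : ∀ u v i j → u ≢ v → update p w (just k) u ≡ just i → update p w (just k) v ≡ just j →
    (red c u v , blue c u v) ≡ partColors i j
  coloured′ u v i j u≢v pu pv with u ≟ᶠ w | v ≟ᶠ w
  coloured′ u v i j u≢v pu   pv   | yes refl | yes refl = contradiction refl u≢v
  coloured′ u v k j u≢v refl pv   | yes refl | no _     = replica v j pv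
  coloured′ u v i k u≢v pu   refl | no _     | yes refl =
    trans (cong₂ _,_ (red-sym c u w) (blue-sym c u w)) (trans (replica u i pu) (partColors-sym k i))
  coloured′ u v i j u≢v pu   pv   | no _     | no _     = coloured u v i j u≢v pu pv

all-or-counterexample : ∀ {n} {A : Set} (q : Fin n → Maybe A) (f : Fin n → Bool) →
  (∀ v → q v ≢ nothing → f v ≡ true) ⊎ ∃ λ v → ∃ λ i → q v ≡ just i × f v ≡ false
all-or-counterexample {ℕ.zero} q f = inj₁ λ ()
all-or-counterexample {ℕ.suc n} q f with all-or-counterexample (q ∘ suc) (f ∘ suc)
... | inj₂ (v , i , qv , fv) = inj₂ (suc v , i , qv , fv)
... | inj₁ rest with q zero in q0 | f zero in f0
...   | nothing | _     = inj₁ λ { zero q0≢ → contradiction q0 q0≢ ; (suc v) → rest v }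
...   | just i  | false = inj₂ (zero , i , q0 , f0)
...   | just i  | true  = inj₁ λ { zero _ → f0 ; (suc v) → rest v }

module Outside {n} (c : Coloring n) (red-C4-free : ¬ InducedC4 (red c)) (blue-C4-free : ¬ InducedC4 (blue c))
  (p : Fin n → Maybe (Fin 5)) (maximal : IsMaximalBlowup c p) (w : Fin n) (w∉K : p w ≡ nothing) where

  nonempty : ∀ i → ∃ λ v → p v ≡ just i
  nonempty = proj₁ (proj₁ maximal)

  w≢ : ∀ {v i} → p v ≡ just i → w ≢ v
  w≢ pv refl = contradiction (trans (sym w∉K) pv) λ ()

  distinct : ∀ {u v P Q γ} → p u ≡ just P → p v ≡ just Q →
    partColors P Q ≡ γ → γ ≢ (true , true) → u ≢ v
  distinct {P = P} pu pv PQ γ≢ refl with trans (sym pu) pv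
  ... | refl = γ≢ (trans (sym PQ) (partColors-diag P))

  coloured : ∀ {u v P Q γ} → p u ≡ just P → p v ≡ just Q →
    partColors P Q ≡ γ → γ ≢ (true , true) → (red c u v , blue c u v) ≡ γ
  coloured pu pv PQ γ≢ = trans (proj₂ (proj₁ maximal) _ _ _ _ (distinct pu pv PQ γ≢) pu pv) PQ

  red-path : ∀ {u v x P Q S} → p u ≡ just P → p v ≡ just Q → p x ≡ just S →
    partColors P Q ≡ (true , false) → partColors Q S ≡ (true , false) → partColors P S ≡ (false , true) →
    red c w u ≡ true → red c w x ≡ true → red c w v ≡ true
  red-path {x = x} pu pv px PQ QS PS wu wx =
    C4-free⇒chord red-C4-free (w≢ pu) (w≢ pv) (w≢ px)
      (distinct pu pv PQ λ ()) (distinct pu px PS λ ()) (distinct pv px QS λ ())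
      wu (cong proj₁ (coloured pu pv PQ λ ())) (cong proj₁ (coloured pv px QS λ ()))
      (trans (red-sym c x w) wx) (cong proj₁ (coloured pu px PS λ ()))

  blue-path : ∀ {u v x P Q S} → p u ≡ just P → p v ≡ just Q → p x ≡ just S →
    partColors P Q ≡ (false , true) → partColors Q S ≡ (false , true) → partColors P S ≡ (true , false) →
    blue c w u ≡ true → blue c w x ≡ true → blue c w v ≡ true
  blue-path {x = x} pu pv px PQ QS PS wu wx =
    C4-free⇒chord blue-C4-free (w≢ pu) (w≢ pv) (w≢ px)
      (distinct pu pv PQ λ ()) (distinct pu px PS λ ()) (distinct pv px QS λ ())
      wu (cong proj₂ (coloured pu pv PQ λ ())) (cong proj₂ (coloured pv px QS λ ()))
      (trans (blue-sym c x w) wx) (cong proj₂ (coloured pu px PS λ ()))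

  blue-only : ∀ {v i} → p v ≡ just i → red c w v ≡ false → (red c w v , blue c w v) ≡ (false , true)
  blue-only {v} pv wv with covered c w v (w≢ pv)
  ... | inj₁ wv′ = contradiction (trans (sym wv′) wv) λ ()
  ... | inj₂ wv′ = cong₂ _,_ wv wv′

  red-only : ∀ {v i} → p v ≡ just i → blue c w v ≡ false → (red c w v , blue c w v) ≡ (true , false)
  red-only {v} pv wv with covered c w v (w≢ pv)
  ... | inj₁ wv′ = cong₂ _,_ wv′ wv
  ... | inj₂ wv′ = contradiction (trans (sym wv′) wv) λ ()

  not-replica : ∀ k → ¬ (∀ v j → p v ≡ just j → (red c w v , blue c w v) ≡ partColors k j)
  not-replica k replica = proj₂ maximal w k w∉K (isBlowup-update {c = c} {k = k} (proj₁ maximal) w∉K replica)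

  Mixed : Fin 5 → Fin 5 → Set
  Mixed i j = ∃ λ a → ∃ λ b → p a ≡ just i × p b ≡ just j × red c w a ≡ false × blue c w b ≡ false

  ¬adjacent : (σ : Automorphism) → ¬ Mixed (apply σ 0F) (apply σ 1F)
  ¬adjacent σ (a , b , pa , pb , wa , wb) with nonempty (apply σ 3F) | nonempty (apply σ 4F)
  ... | v₃ , pv₃ | v₄ , pv₄ = not-replica (apply σ 2F) replica
    where
    wa-blue : blue c w a ≡ true
    wa-blue = cong proj₂ (blue-only pa wa)

    wb-red : red c w b ≡ true
    wb-red = cong proj₁ (red-only pb wb)

    X₄-not-red : ∀ {v} → p v ≡ just (apply σ 4F) → red c w v ≡ false
    X₄-not-red pv = contraposeᵇ
      (λ wv → red-path pv pa pb (preserves σ 4F 0F) (preserves σ 0F 1F) (preserves σ 4F 1F) wv wb-red) wa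

    wv₄-blue : blue c w v₄ ≡ true
    wv₄-blue = cong proj₂ (blue-only pv₄ (X₄-not-red pv₄))

    X₃-not-blue : ∀ {v} → p v ≡ just (apply σ 3F) → blue c w v ≡ false
    X₃-not-blue pv = contraposeᵇ
      (λ wv → blue-path pv₄ pb pv (preserves σ 4F 1F) (preserves σ 1F 3F) (preserves σ 4F 3F) wv₄-blue wv) wb

    wv₃-red : red c w v₃ ≡ true
    wv₃-red = cong proj₁ (red-only pv₃ (X₃-not-blue pv₃))

    X₂-red : ∀ {v} → p v ≡ just (apply σ 2F) → red c w v ≡ true
    X₂-red pv = red-path pb pv pv₃ (preserves σ 1F 2F) (preserves σ 2F 3F) (preserves σ 1F 3F) wb-red wv₃-red

    X₂-blue : ∀ {v} → p v ≡ just (apply σ 2F) → blue c w v ≡ true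
    X₂-blue pv = blue-path pa pv pv₄ (preserves σ 0F 2F) (preserves σ 2F 4F) (preserves σ 0F 4F) wa-blue wv₄-blue

    X₀-not-red : ∀ {v} → p v ≡ just (apply σ 0F) → red c w v ≡ false
    X₀-not-red pv = contraposeᵇ
      (λ wv → red-path pv₃ pv₄ pv (preserves σ 3F 4F) (preserves σ 4F 0F) (preserves σ 3F 0F) wv₃-red wv)
      (X₄-not-red pv₄)

    X₁-not-blue : ∀ {v} → p v ≡ just (apply σ 1F) → blue c w v ≡ false
    X₁-not-blue pv = contraposeᵇ
      (λ wv → blue-path pv pv₃ pa (preserves σ 1F 3F) (preserves σ 3F 0F) (preserves σ 1F 0F) wv wa-blue)
      (X₃-not-blue pv₃)

    replica-of-X₂ : ∀ v x → p v ≡ just (apply σ x) → (red c w v , blue c w v) ≡ partColors 2F x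
    replica-of-X₂ v 0F pv = blue-only pv (X₀-not-red pv)
    replica-of-X₂ v 1F pv = red-only pv (X₁-not-blue pv)
    replica-of-X₂ v 2F pv = cong₂ _,_ (X₂-red pv) (X₂-blue pv)
    replica-of-X₂ v 3F pv = red-only pv (X₃-not-blue pv)
    replica-of-X₂ v 4F pv = blue-only pv (X₄-not-red pv)

    replica : ∀ v j → p v ≡ just j → (red c w v , blue c w v) ≡ partColors (apply σ 2F) j
    replica v j pv with surjective σ j
    ... | x , refl = trans (replica-of-X₂ v x pv) (sym (preserves σ 2F x))

  ¬mixed-from : (σ : Automorphism) (k : Fin 5) → ¬ Mixed (apply σ 0F) (apply σ k)
  ¬mixed-from σ 1F m = ¬adjacent σ m
  ¬mixed-from σ 4F m = ¬adjacent (σ ∘ᴬ reflection 0F) m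
  ¬mixed-from σ 2F (a , b , pa , pb , wa , wb) with nonempty (apply σ 4F)
  ... | x , px = ¬adjacent (σ ∘ᴬ reflection 0F) (a , x , pa , px , wa , contraposeᵇ
    (λ wx → blue-path pa pb px (preserves σ 0F 2F) (preserves σ 2F 4F) (preserves σ 0F 4F)
      (cong proj₂ (blue-only pa wa)) wx) wb)
  ¬mixed-from σ 3F (a , b , pa , pb , wa , wb) with nonempty (apply σ 1F)
  ... | x , px = ¬adjacent σ (a , x , pa , px , wa , contraposeᵇ
    (λ wx → blue-path px pb pa (preserves σ 1F 3F) (preserves σ 3F 0F) (preserves σ 1F 0F)
      wx (cong proj₂ (blue-only pa wa))) wb)
  ¬mixed-from σ 0F (a , b , pa , pb , wa , wb) with nonempty (apply σ 1F) | nonempty (apply σ 4F)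
  ... | v₁ , pv₁ | v₄ , pv₄ with red c w v₁ in wv₁
  ...   | false = ¬adjacent (σ ∘ᴬ reflection 1F) (v₁ , b , pv₁ , pb , wv₁ , wb)
  ...   | true  = ¬adjacent (σ ∘ᴬ rotation 4F) (v₄ , b , pv₄ , pb , contraposeᵇ
    (λ wv₄ → red-path pv₄ pa pv₁ (preserves σ 4F 0F) (preserves σ 0F 1F) (preserves σ 4F 1F) wv₄ wv₁) wa , wb)

  ¬mixed : ∀ i j → ¬ Mixed i j
  ¬mixed i j m with surjective (rotation i) j
  ... | k , refl = ¬mixed-from (rotation i) k (subst (λ i′ → Mixed i′ (i ⊕ k)) (sym (⊕-identityʳ i)) m)

lemma2p3 : (n : ℕ) (c : Coloring n) →
    ¬ InducedC4 (red c) → ¬ InducedC4 (blue c) →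
    (p : Fin n → Maybe (Fin 5)) → IsMaximalBlowup c p →
    (w : Fin n) → p w ≡ nothing →
    (∀ (v : Fin n) → p v ≢ nothing → red c w v ≡ true) ⊎
    (∀ (v : Fin n) → p v ≢ nothing → blue c w v ≡ true)
lemma2p3 n c red-C4-free blue-C4-free p maximal w w∉K
  with all-or-counterexample p (red c w) | all-or-counterexample p (blue c w)
... | inj₁ all-red | _              = inj₁ all-red
... | inj₂ _       | inj₁ all-blue  = inj₂ all-blue
... | inj₂ (a , i , pa , wa) | inj₂ (b , j , pb , wb) =
  ⊥-elim (Outside.¬mixed c red-C4-free blue-C4-free p maximal w w∉K i j (a , b , pa , pb , wa , wb))
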